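{- For $n\ge 0$ let \[ S_n(q)=\sum_{k=0}^{\lfloor n/2\rfloor}(-1)^k \binom{n-k}{k}_q q^{k(k-1)/2}\, q^{n-k}. \] Then for all integers $n\ge 2$, \[ S_n(q) = q^{\lfloor (n+2)/3\rfloor} S_{n-1}(q) - q^{\lfloor (2n+1)/3\rfloor} S_{n-2}(q). \]
   Context: The $q$-binomial coefficient is $\binom{m}{k}_q=\frac{[m][m-1]\cdots[m-k+1]}{[1][2]\cdots[k]}$ for $k\in\mathbb{N}$, $\binom{m}{0}_q=1$, where $[m]=(1-q^m)/(1-q)$. -}

module Defs where

-- Formal power series over ℤ in the indeterminate q, represented by their
-- coefficient functions.  Polynomials (in particular q-binomial coefficients)
-- embed in ℤ[[q]], and an identity of polynomials holds iff it holds in ℤ[[q]].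

open import Data.Nat as ℕ using (ℕ; zero; suc; _∸_; _%_)
open import Data.Integer as ℤ using (ℤ; 0ℤ; 1ℤ)
open import Relation.Nullary using (yes; no)
open import Relation.Binary.PropositionalEquality using (_≡_)

Series : Set
Series = ℕ → ℤ

infix 4 _≈_
_≈_ : Series → Series → Set
f ≈ g = ∀ i → f i ≡ g i

sumS : ℕ → (ℕ → Series) → Series
sumS zero    f i = 0ℤ
sumS (suc n) f i = sumS n f i ℤ.+ f n i

sumℤ : ℕ → (ℕ → ℤ) → ℤ
sumℤ zero    a = 0ℤ
sumℤ (suc n) a = sumℤ n a ℤ.+ a n

infixl 6 _+S_ _-S_
infixl 7 _*S_

_+S_ : Series → Series → Series
(f +S g) i = f i ℤ.+ g i

-S_ : Series → Series
(-S f) i = ℤ.- f i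

_-S_ : Series → Series → Series
f -S g = f +S (-S g)

_*S_ : Series → Series → Series
(f *S g) i = sumℤ (suc i) (λ j → f j ℤ.* g (i ∸ j))

oneS : Series
oneS zero    = 1ℤ
oneS (suc _) = 0ℤ

qPow : ℕ → Series
qPow e i with e ℕ.≟ i
... | yes _ = 1ℤ
... | no  _ = 0ℤ

signS : ℕ → Series
signS zero    = oneS
signS (suc k) = -S signS k

prodS : ℕ → (ℕ → Series) → Series
prodS zero    f = oneS
prodS (suc n) f = prodS n f *S f n

-- the inverse of 1 - q^(j+1) in ℤ[[q]], namely Σ_t q^((j+1) t)
invOneMinusQPow : ℕ → Series
invOneMinusQPow j i with i % suc j ℕ.≟ 0
... | yes _ = 1ℤ
... | no  _ = 0ℤ

qInt : ℕ → Series
qInt m = (oneS -S qPow m) *S invOneMinusQPow 0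

-- the inverse of [j+1] = (1 - q^(j+1))/(1 - q), i.e. (1 - q)/(1 - q^(j+1))
invQInt : ℕ → Series
invQInt j = (oneS -S qPow 1) *S invOneMinusQPow j

qBinom : ℕ → ℕ → Series
qBinom m k = prodS k (λ i → qInt (m ∸ i)) *S prodS k (λ j → invQInt j)

S : ℕ → Series
S n = sumS (suc (n ℕ./ 2)) (λ k →
        signS k *S qBinom (n ∸ k) k *S qPow ((k ℕ.* (k ∸ 1)) ℕ./ 2) *S qPow (n ∸ k))

module Submission where

-- Replacing the q-binomials by the Gaussian polynomials of the q-Pascal rule and splitting off
-- the factor q^(n-k), S_n is paired with T_n = Σ_k (-1)^k [n-k choose k] q^(k(k-1)/2). The two
-- q-Pascal rules give T_(n+2) = T_(n+1) - S_n and S_(n+2) = q^(n+2) T_(n+1) - q^(n+1) T_n, hence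
-- T_(n+3) = -q^(n+1) T_n. So T_(3t) = (-1)^t q^(t(3t-1)/2), T_(3t+1) = (-1)^t q^(t(3t+1)/2) and
-- T_(3t+2) = 0; S_n is then a signed pentagonal monomial or binomial depending on n mod 3, and
-- the recurrence is checked in each residue class.

open import Defs
open import Data.Nat using (ℕ; _≤_; _+_; _*_; _∸_; _/_)

open import Algebra.Bundles using (CommutativeRing)
import Algebra.Properties.CommutativeSemigroup as CommutativeSemigroupProperties
import Algebra.Properties.Ring as RingProperties
import Algebra.Solver.Ring
open import Algebra.Solver.Ring.AlmostCommutativeRing
  using (fromCommutativeRing; _-Raw-AlmostCommutative⟶_)
open import Data.Integer as ℤ using (ℤ; 0ℤ; 1ℤ)
import Data.Integer.Properties as ℤₚ
open import Data.Integer.Tactic.RingSolver using () renaming (solve-∀ to solveℤ-∀)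
open import Data.List using (_∷_; [])
open import Data.Maybe using (Maybe; just; nothing)
open import Data.Nat as ℕ using (zero; suc; _<_; z≤n; s≤s; _%_)
import Data.Nat.DivMod as ℕ
import Data.Nat.Divisibility as ℕ
import Data.Nat.Properties as ℕₚ
open import Data.Nat.Tactic.RingSolver using (solve-∀) renaming (solve to solveℕ)
open import Data.Product using (_,_)
open import Data.Sum using (inj₁; inj₂)
open import Function using (_∘_)
open import Relation.Binary.PropositionalEquality
  using (_≡_; _≢_; refl; sym; trans; cong; cong₂; subst; module ≡-Reasoning)
import Relation.Binary.Reasoning.Setoid
open import Relation.Nullary using (yes; no; contradiction)

sumℤ-cong : ∀ n {a b : ℕ → ℤ} → (∀ j → j < n → a j ≡ b j) → sumℤ n a ≡ sumℤ n b
sumℤ-cong zero    a≡b = refl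
sumℤ-cong (suc n) a≡b =
  cong₂ ℤ._+_ (sumℤ-cong n (λ j j<n → a≡b j (ℕₚ.m<n⇒m<1+n j<n))) (a≡b n ℕₚ.≤-refl)

sumℤ-zero : ∀ n {a : ℕ → ℤ} → (∀ j → j < n → a j ≡ 0ℤ) → sumℤ n a ≡ 0ℤ
sumℤ-zero zero    a≡0 = refl
sumℤ-zero (suc n) a≡0 = cong₂ ℤ._+_ (sumℤ-zero n (λ j j<n → a≡0 j (ℕₚ.m<n⇒m<1+n j<n))) (a≡0 n ℕₚ.≤-refl)

sumℤ-distrib-+ : ∀ n (a b : ℕ → ℤ) → sumℤ n (λ j → a j ℤ.+ b j) ≡ sumℤ n a ℤ.+ sumℤ n b
sumℤ-distrib-+ zero    a b = refl
sumℤ-distrib-+ (suc n) a b = trans (cong (ℤ._+ (a n ℤ.+ b n)) (sumℤ-distrib-+ n a b))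
  (CommutativeSemigroupProperties.interchange ℤₚ.+-commutativeSemigroup (sumℤ n a) (sumℤ n b) (a n) (b n))

*-distribˡ-sumℤ : ∀ n c (a : ℕ → ℤ) → c ℤ.* sumℤ n a ≡ sumℤ n (λ j → c ℤ.* a j)
*-distribˡ-sumℤ zero    c a = ℤₚ.*-zeroʳ c
*-distribˡ-sumℤ (suc n) c a =
  trans (ℤₚ.*-distribˡ-+ c (sumℤ n a) (a n)) (cong (ℤ._+ (c ℤ.* a n)) (*-distribˡ-sumℤ n c a))

sumℤ-suc : ∀ n (a : ℕ → ℤ) → sumℤ (suc n) a ≡ a 0 ℤ.+ sumℤ n (a ∘ suc)
sumℤ-suc zero    a = trans (ℤₚ.+-identityˡ (a 0)) (sym (ℤₚ.+-identityʳ (a 0)))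
sumℤ-suc (suc n) a =
  trans (cong (ℤ._+ a (suc n)) (sumℤ-suc n a)) (ℤₚ.+-assoc (a 0) (sumℤ n (a ∘ suc)) (a (suc n)))

sumℤ-reverse : ∀ n (a : ℕ → ℤ) → sumℤ (suc n) a ≡ sumℤ (suc n) (λ j → a (n ∸ j))
sumℤ-reverse zero    a = refl
sumℤ-reverse (suc n) a = begin
  sumℤ (suc n) a ℤ.+ a (suc n)                     ≡⟨ cong (ℤ._+ a (suc n)) (sumℤ-reverse n a) ⟩
  sumℤ (suc n) (λ j → a (n ∸ j)) ℤ.+ a (suc n)     ≡⟨ ℤₚ.+-comm _ (a (suc n)) ⟩
  a (suc n) ℤ.+ sumℤ (suc n) (λ j → a (n ∸ j))     ≡⟨ sym (sumℤ-suc (suc n) (λ j → a (suc n ∸ j))) ⟩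
  sumℤ (suc (suc n)) (λ j → a (suc n ∸ j))         ∎
  where open ≡-Reasoning

-- The ring of formal power series

zeroS : Series
zeroS _ = 0ℤ

tailS : Series → Series
tailS f i = f (suc i)

infixr 8 _·S_
_·S_ : ℤ → Series → Series
(c ·S f) i = c ℤ.* f i

*S-cong : ∀ {f f′ g g′} → f ≈ f′ → g ≈ g′ → f *S g ≈ f′ *S g′
*S-cong f≈f′ g≈g′ i = sumℤ-cong (suc i) (λ j _ → cong₂ ℤ._*_ (f≈f′ j) (g≈g′ (i ∸ j)))

*S-comm : ∀ f g → f *S g ≈ g *S f
*S-comm f g i = trans (sumℤ-reverse i _) (sumℤ-cong (suc i) λ j j≤i →
  trans (cong (λ k → f (i ∸ j) ℤ.* g k) (ℕₚ.m∸[m∸n]≡n (ℕₚ.≤-pred j≤i))) (ℤₚ.*-comm (f (i ∸ j)) (g j)))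

*S-distribʳ : ∀ f g h → (f +S g) *S h ≈ f *S h +S g *S h
*S-distribʳ f g h i = trans (sumℤ-cong (suc i) (λ j _ → ℤₚ.*-distribʳ-+ (h (i ∸ j)) (f j) (g j)))
                            (sumℤ-distrib-+ (suc i) _ _)

*S-at-zero : ∀ f g → (f *S g) 0 ≡ f 0 ℤ.* g 0
*S-at-zero f g = ℤₚ.+-identityˡ _

*S-at-suc : ∀ f g i → (f *S g) (suc i) ≡ f 0 ℤ.* g (suc i) ℤ.+ (tailS f *S g) i
*S-at-suc f g i = sumℤ-suc (suc i) _

·S-*S-assoc : ∀ c f g i → ((c ·S f) *S g) i ≡ c ℤ.* (f *S g) i
·S-*S-assoc c f g i = trans (sumℤ-cong (suc i) (λ j _ → ℤₚ.*-assoc c (f j) (g (i ∸ j))))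
                      (sym (*-distribˡ-sumℤ (suc i) c _))

*S-assoc : ∀ f g h i → ((f *S g) *S h) i ≡ (f *S (g *S h)) i
*S-assoc f g h zero = begin
  ((f *S g) *S h) 0       ≡⟨ *S-at-zero (f *S g) h ⟩
  (f *S g) 0 ℤ.* h 0      ≡⟨ cong (ℤ._* h 0) (*S-at-zero f g) ⟩
  f 0 ℤ.* g 0 ℤ.* h 0     ≡⟨ ℤₚ.*-assoc (f 0) (g 0) (h 0) ⟩
  f 0 ℤ.* (g 0 ℤ.* h 0)   ≡⟨ cong (f 0 ℤ.*_) (sym (*S-at-zero g h)) ⟩
  f 0 ℤ.* (g *S h) 0      ≡⟨ sym (*S-at-zero f (g *S h)) ⟩
  (f *S (g *S h)) 0       ∎
  where open ≡-Reasoning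
*S-assoc f g h (suc i) = begin
  ((f *S g) *S h) (suc i)
    ≡⟨ *S-at-suc (f *S g) h i ⟩
  (f *S g) 0 ℤ.* h (suc i) ℤ.+ (tailS (f *S g) *S h) i
    ≡⟨ cong₂ ℤ._+_ (cong (ℤ._* h (suc i)) (*S-at-zero f g)) (*S-cong {g = h} (*S-at-suc f g) (λ _ → refl) i) ⟩
  f₀ ℤ.* g 0 ℤ.* h (suc i) ℤ.+ ((f₀ ·S tailS g +S tailS f *S g) *S h) i
    ≡⟨ cong (ℤ._+_ (f₀ ℤ.* g 0 ℤ.* h (suc i))) (*S-distribʳ (f₀ ·S tailS g) (tailS f *S g) h i) ⟩
  f₀ ℤ.* g 0 ℤ.* h (suc i) ℤ.+ (((f₀ ·S tailS g) *S h) i ℤ.+ ((tailS f *S g) *S h) i)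
    ≡⟨ cong₂ (λ x y → f₀ ℤ.* g 0 ℤ.* h (suc i) ℤ.+ (x ℤ.+ y)) (·S-*S-assoc f₀ (tailS g) h i) (*S-assoc (tailS f) g h i) ⟩
  f₀ ℤ.* g 0 ℤ.* h (suc i) ℤ.+ (f₀ ℤ.* (tailS g *S h) i ℤ.+ (tailS f *S (g *S h)) i)
    ≡⟨ regroup f₀ (g 0) (h (suc i)) ((tailS g *S h) i) ((tailS f *S (g *S h)) i) ⟩
  f₀ ℤ.* (g 0 ℤ.* h (suc i) ℤ.+ (tailS g *S h) i) ℤ.+ (tailS f *S (g *S h)) i
    ≡⟨ cong (λ x → f₀ ℤ.* x ℤ.+ (tailS f *S (g *S h)) i) (sym (*S-at-suc g h i)) ⟩
  f₀ ℤ.* (g *S h) (suc i) ℤ.+ (tailS f *S (g *S h)) i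
    ≡⟨ sym (*S-at-suc f (g *S h) i) ⟩
  (f *S (g *S h)) (suc i) ∎
  where
  open ≡-Reasoning
  f₀ = f 0
  regroup : ∀ a b c d e → a ℤ.* b ℤ.* c ℤ.+ (a ℤ.* d ℤ.+ e) ≡ a ℤ.* (b ℤ.* c ℤ.+ d) ℤ.+ e
  regroup = solveℤ-∀

*S-identityˡ : ∀ f → oneS *S f ≈ f
*S-identityˡ f zero    = trans (*S-at-zero oneS f) (ℤₚ.*-identityˡ (f 0))
*S-identityˡ f (suc i) = begin
  (oneS *S f) (suc i)                     ≡⟨ *S-at-suc oneS f i ⟩
  1ℤ ℤ.* f (suc i) ℤ.+ (zeroS *S f) i     ≡⟨ cong (ℤ._+_ (1ℤ ℤ.* f (suc i)))
                                                  (sumℤ-zero (suc i) (λ j _ → ℤₚ.*-zeroˡ (f (i ∸ j)))) ⟩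
  1ℤ ℤ.* f (suc i) ℤ.+ 0ℤ                 ≡⟨ ℤₚ.+-identityʳ _ ⟩
  1ℤ ℤ.* f (suc i)                        ≡⟨ ℤₚ.*-identityˡ _ ⟩
  f (suc i)                               ∎
  where open ≡-Reasoning

seriesRing : CommutativeRing _ _
seriesRing = record
  { Carrier = Series ; _≈_ = _≈_ ; _+_ = _+S_ ; _*_ = _*S_ ; -_ = -S_ ; 0# = zeroS ; 1# = oneS
  ; isCommutativeRing = record
    { isRing = record
      { +-isAbelianGroup = record
        { isGroup = record
          { isMonoid = record
            { isSemigroup = record
              { isMagma = record
                { isEquivalence = record
                  { refl = λ _ → refl ; sym = λ p i → sym (p i) ; trans = λ p q i → trans (p i) (q i) }
                ; ∙-cong = λ p q i → cong₂ ℤ._+_ (p i) (q i) }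
              ; assoc = λ f g h i → ℤₚ.+-assoc (f i) (g i) (h i) }
            ; identity = (λ f i → ℤₚ.+-identityˡ (f i)) , (λ f i → ℤₚ.+-identityʳ (f i)) }
          ; inverse = (λ f i → ℤₚ.+-inverseˡ (f i)) , (λ f i → ℤₚ.+-inverseʳ (f i))
          ; ⁻¹-cong = λ p i → cong ℤ.-_ (p i) }
        ; comm = λ f g i → ℤₚ.+-comm (f i) (g i) }
      ; *-cong = *S-cong
      ; *-assoc = *S-assoc
      ; *-identity = *S-identityˡ , (λ f i → trans (*S-comm f oneS i) (*S-identityˡ f i))
      ; distrib = (λ f g h i → trans (*S-comm f (g +S h) i) (trans (*S-distribʳ g h f i)
                                 (cong₂ ℤ._+_ (*S-comm g f i) (*S-comm h f i))))
                , (λ h f g → *S-distribʳ f g h) }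
    ; *-comm = *S-comm } }

open CommutativeRing seriesRing
  using (setoid; +-cong; +-comm; +-assoc; *-cong; *-assoc; *-comm; *-identityˡ; *-identityʳ; -‿inverseʳ; distribˡ;
         zeroˡ; zeroʳ; +-identityˡ; +-identityʳ)
  renaming (refl to ≈-refl; sym to ≈-sym; trans to ≈-trans; reflexive to ≈-reflexive)

-- Integer constants, so that the ring solver can decide equality of coefficients.
constS : ℤ → Series
constS c zero    = c
constS c (suc _) = 0ℤ

constS-* : ∀ a b → constS (a ℤ.* b) ≈ constS a *S constS b
constS-* a b zero    = sym (*S-at-zero (constS a) (constS b))
constS-* a b (suc i) = sym (begin
  (constS a *S constS b) (suc i)      ≡⟨ *S-at-suc (constS a) (constS b) i ⟩
  a ℤ.* 0ℤ ℤ.+ (zeroS *S constS b) i  ≡⟨ cong₂ ℤ._+_ (ℤₚ.*-zeroʳ a)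
                                             (sumℤ-zero (suc i) (λ j _ → ℤₚ.*-zeroˡ (constS b (i ∸ j)))) ⟩
  0ℤ                                  ∎)
  where open ≡-Reasoning

constS-hom : ℤ.+-*-rawRing -Raw-AlmostCommutative⟶ fromCommutativeRing seriesRing
constS-hom = record
  { ⟦_⟧    = constS
  ; +-homo = λ { a b zero → refl ; a b (suc i) → refl }
  ; *-homo = constS-*
  ; -‿homo = λ { a zero → refl ; a (suc i) → refl }
  ; 0-homo = λ { zero → refl ; (suc i) → refl }
  ; 1-homo = λ { zero → refl ; (suc i) → refl } }

constS-≟ : ∀ a b → Maybe (constS a ≈ constS b)
constS-≟ a b with a ℤ.≟ b
... | yes refl = just ≈-refl
... | no _     = nothing

oneS≈constS1 : oneS ≈ constS 1ℤ
oneS≈constS1 zero    = refl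
oneS≈constS1 (suc _) = refl

open Algebra.Solver.Ring ℤ.+-*-rawRing (fromCommutativeRing seriesRing) constS-hom constS-≟
  using (solve; _:=_; _:+_; _:*_; :-_; _:-_; con)

open RingProperties (CommutativeRing.ring seriesRing) using (-‿distribˡ-*; -0#≈0#)

module ≈-Reasoning = Relation.Binary.Reasoning.Setoid setoid

*S-congˡ : ∀ f {g h} → g ≈ h → f *S g ≈ f *S h
*S-congˡ f = *S-cong {f} (λ _ → refl)

*S-congʳ : ∀ h {f g} → f ≈ g → f *S h ≈ g *S h
*S-congʳ h f≈g = *S-cong {g = h} f≈g (λ _ → refl)

+S-congˡ : ∀ f {g h} → g ≈ h → f +S g ≈ f +S h
+S-congˡ f g≈h i = cong (ℤ._+_ (f i)) (g≈h i)

+S-congʳ : ∀ h {f g} → f ≈ g → f +S h ≈ g +S h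
+S-congʳ h f≈g i = cong (ℤ._+ h i) (f≈g i)

-S-cong : ∀ {f g} → f ≈ g → -S f ≈ -S g
-S-cong f≈g i = cong ℤ.-_ (f≈g i)

*S-irrelevantʳ : ∀ f g h → f ≈ zeroS → f *S g ≈ f *S h
*S-irrelevantʳ f g h f≈0 = begin
  f *S g      ≈⟨ *S-congʳ g f≈0 ⟩
  zeroS *S g  ≈⟨ zeroˡ g ⟩
  zeroS       ≈⟨ ≈-sym (zeroˡ h) ⟩
  zeroS *S h  ≈⟨ *S-congʳ h (≈-sym f≈0) ⟩
  f *S h      ∎
  where open ≈-Reasoning

qPow-diag : ∀ e → qPow e e ≡ 1ℤ
qPow-diag e with e ℕ.≟ e
... | yes _   = refl
... | no e≢e = contradiction refl e≢e

qPow-off : ∀ {e i} → e ≢ i → qPow e i ≡ 0ℤ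
qPow-off {e} {i} e≢i with e ℕ.≟ i
... | yes e≡i = contradiction e≡i e≢i
... | no _    = refl

qPow-≡ : ∀ {e i e′ i′} → (e ≡ i → e′ ≡ i′) → (e′ ≡ i′ → e ≡ i) → qPow e i ≡ qPow e′ i′
qPow-≡ {e} {i} {e′} {i′} to from with e ℕ.≟ i
... | yes e≡i = sym (subst (λ k → qPow e′ k ≡ 1ℤ) (to e≡i) (qPow-diag e′))
... | no  e≢i = sym (qPow-off (e≢i ∘ from))

sumℤ-qPow-beyond : ∀ n e (g : ℕ → ℤ) → n ≤ e → sumℤ n (λ j → qPow e j ℤ.* g j) ≡ 0ℤ
sumℤ-qPow-beyond n e g n≤e = sumℤ-zero n λ j j<n →
  trans (cong (ℤ._* g j) (qPow-off (ℕₚ.<⇒≢ (ℕₚ.<-≤-trans j<n n≤e) ∘ sym))) (ℤₚ.*-zeroˡ (g j))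

sumℤ-qPow-at : ∀ n e (g : ℕ → ℤ) → e < n → sumℤ n (λ j → qPow e j ℤ.* g j) ≡ g e
sumℤ-qPow-at (suc n) e g e<1+n with ℕₚ.m<1+n⇒m<n∨m≡n e<1+n
... | inj₂ refl = trans (cong₂ ℤ._+_ (sumℤ-qPow-beyond e e g ℕₚ.≤-refl) (cong (ℤ._* g e) (qPow-diag e)))
                        (trans (ℤₚ.+-identityˡ _) (ℤₚ.*-identityˡ (g e)))
... | inj₁ e<n  = trans (cong₂ ℤ._+_ (sumℤ-qPow-at n e g e<n)
                                     (trans (cong (ℤ._* g n) (qPow-off (ℕₚ.<⇒≢ e<n))) (ℤₚ.*-zeroˡ (g n))))
                        (ℤₚ.+-identityʳ (g e))

qPow-*S-≤ : ∀ e f {i} → e ≤ i → (qPow e *S f) i ≡ f (i ∸ e)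
qPow-*S-≤ e f {i} e≤i = sumℤ-qPow-at (suc i) e (λ j → f (i ∸ j)) (s≤s e≤i)

qPow-*S-< : ∀ e f {i} → i < e → (qPow e *S f) i ≡ 0ℤ
qPow-*S-< e f {i} i<e = sumℤ-qPow-beyond (suc i) e (λ j → f (i ∸ j)) i<e

qPow-+ : ∀ a b → qPow a *S qPow b ≈ qPow (a + b)
qPow-+ a b i with a ℕ.≤? i
... | yes a≤i = trans (qPow-*S-≤ a (qPow b) a≤i)
  (qPow-≡ (λ b≡i∸a → trans (cong (a +_) b≡i∸a) (ℕₚ.m+[n∸m]≡n a≤i))
          (λ a+b≡i → trans (sym (ℕₚ.m+n∸m≡n a b)) (cong (_∸ a) a+b≡i)))
... | no  a≰i = trans (qPow-*S-< a (qPow b) (ℕₚ.≰⇒> a≰i))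
  (sym (qPow-off λ a+b≡i → a≰i (subst (a ≤_) a+b≡i (ℕₚ.m≤m+n a b))))

qPow-+-≡ : ∀ a b c → a + b ≡ c → qPow a *S qPow b ≈ qPow c
qPow-+-≡ a b c a+b≡c = ≈-trans (qPow-+ a b) (≈-reflexive (cong qPow a+b≡c))

qPow-*S-qPow-≡ : ∀ a b c d → a + b ≡ c + d → qPow a *S qPow b ≈ qPow c *S qPow d
qPow-*S-qPow-≡ a b c d a+b≡c+d = ≈-trans (qPow-+-≡ a b (c + d) a+b≡c+d) (≈-sym (qPow-+ c d))

qPow-zero : qPow 0 ≈ oneS
qPow-zero zero    = qPow-diag 0
qPow-zero (suc i) = qPow-off {0} {suc i} λ ()

invOneMinusQPow-≡ : ∀ j i i′ → i % suc j ≡ i′ % suc j → invOneMinusQPow j i ≡ invOneMinusQPow j i′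
invOneMinusQPow-≡ j i i′ i≡i′ with i % suc j ℕ.≟ 0 | i′ % suc j ℕ.≟ 0
... | yes _   | yes _    = refl
... | no  _   | no  _    = refl
... | yes i≡0 | no  i′≢0 = contradiction (trans (sym i≡i′) i≡0) i′≢0
... | no  i≢0 | yes i′≡0 = contradiction (trans i≡i′ i′≡0) i≢0

invOneMinusQPow-< : ∀ j i → 0 < i → i < suc j → invOneMinusQPow j i ≡ 0ℤ
invOneMinusQPow-< j i 0<i i<1+j with i % suc j ℕ.≟ 0
... | yes i%≡0 = contradiction (trans (sym (ℕ.m<n⇒m%n≡m i<1+j)) i%≡0) (ℕₚ.>⇒≢ 0<i)
... | no  _    = refl

-- The coefficients are g i - g (i - j - 1), which vanish for i > j as g is (j+1)-periodic.
invOneMinusQPow-shift : ∀ j → invOneMinusQPow j -S qPow (suc j) *S invOneMinusQPow j ≈ oneS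
invOneMinusQPow-shift j zero =
  cong (λ x → g 0 ℤ.+ ℤ.- x) (qPow-*S-< (suc j) g (s≤s z≤n))
  where g = invOneMinusQPow j
invOneMinusQPow-shift j (suc i) with suc j ℕ.≤? suc i
... | yes 1+j≤1+i = begin
  g (suc i) ℤ.+ ℤ.- (qPow (suc j) *S g) (suc i)  ≡⟨ cong (λ x → g (suc i) ℤ.+ ℤ.- x) (qPow-*S-≤ (suc j) g 1+j≤1+i) ⟩
  g (suc i) ℤ.+ ℤ.- g (i ∸ j)                    ≡⟨ cong (λ x → x ℤ.+ ℤ.- g (i ∸ j)) (invOneMinusQPow-≡ j (suc i) (i ∸ j) period) ⟩
  g (i ∸ j) ℤ.+ ℤ.- g (i ∸ j)                    ≡⟨ ℤₚ.+-inverseʳ (g (i ∸ j)) ⟩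
  0ℤ                                             ∎
  where
  open ≡-Reasoning
  g = invOneMinusQPow j
  period : suc i % suc j ≡ (i ∸ j) % suc j
  period = trans (cong (_% suc j) (sym (ℕₚ.m∸n+n≡m 1+j≤1+i))) (ℕ.[m+n]%n≡m%n (i ∸ j) (suc j))
... | no 1+j≰1+i = begin
  g (suc i) ℤ.+ ℤ.- (qPow (suc j) *S g) (suc i)  ≡⟨ cong₂ (λ x y → x ℤ.+ ℤ.- y) (invOneMinusQPow-< j (suc i) (s≤s z≤n) 1+i<1+j)
                                                                         (qPow-*S-< (suc j) g 1+i<1+j) ⟩
  0ℤ                                             ∎
  where
  open ≡-Reasoning
  g = invOneMinusQPow j
  1+i<1+j = ℕₚ.≰⇒> 1+j≰1+i

invOneMinusQPow-inverse : ∀ j → invOneMinusQPow j *S (oneS -S qPow (suc j)) ≈ oneS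
invOneMinusQPow-inverse j = begin
  g *S (oneS -S Q)      ≈⟨ *S-congˡ g (+S-congʳ (-S Q) oneS≈constS1) ⟩
  g *S (constS 1ℤ -S Q) ≈⟨ solve 2 (λ g Q → g :* (con 1ℤ :- Q) := g :- Q :* g) (λ _ → refl) g Q ⟩
  g -S Q *S g           ≈⟨ invOneMinusQPow-shift j ⟩
  oneS                  ∎
  where
  open ≈-Reasoning
  g = invOneMinusQPow j
  Q = qPow (suc j)

qInt-zero : qInt 0 ≈ zeroS
qInt-zero = begin
  (oneS -S qPow 0) *S I₀  ≈⟨ *S-congʳ I₀ (+S-congˡ oneS (-S-cong qPow-zero)) ⟩
  (oneS -S oneS) *S I₀    ≈⟨ *S-congʳ I₀ (-‿inverseʳ oneS) ⟩
  zeroS *S I₀             ≈⟨ zeroˡ I₀ ⟩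
  zeroS                   ∎
  where
  open ≈-Reasoning
  I₀ = invOneMinusQPow 0

qInt-+ : ∀ a b → qInt a +S qPow a *S qInt b ≈ qInt (a + b)
qInt-+ a b = begin
  (oneS -S X) *S I₀ +S X *S ((oneS -S Y) *S I₀)
    ≈⟨ +-cong (*S-congʳ I₀ (+S-congʳ (-S X) oneS≈constS1))
              (*S-congˡ X (*S-congʳ I₀ (+S-congʳ (-S Y) oneS≈constS1))) ⟩
  (constS 1ℤ -S X) *S I₀ +S X *S ((constS 1ℤ -S Y) *S I₀)
    ≈⟨ solve 3 (λ X Y I → (con 1ℤ :- X) :* I :+ X :* ((con 1ℤ :- Y) :* I) := (con 1ℤ :- X :* Y) :* I)
               (λ _ → refl) X Y I₀ ⟩
  (constS 1ℤ -S X *S Y) *S I₀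
    ≈⟨ *S-congʳ I₀ (+-cong (≈-sym oneS≈constS1) (-S-cong (qPow-+ a b))) ⟩
  (oneS -S qPow (a + b)) *S I₀ ∎
  where
  open ≈-Reasoning
  I₀ = invOneMinusQPow 0
  X = qPow a
  Y = qPow b

qInt-inverse : ∀ j → qInt (suc j) *S invQInt j ≈ oneS
qInt-inverse j = begin
  ((oneS -S Q) *S I₀) *S ((oneS -S qPow 1) *S Iⱼ)
    ≈⟨ solve 5 (λ o Q I₀ Q₁ Iⱼ → ((o :- Q) :* I₀) :* ((o :- Q₁) :* Iⱼ) := (I₀ :* (o :- Q₁)) :* (Iⱼ :* (o :- Q)))
               (λ _ → refl) oneS Q I₀ (qPow 1) Iⱼ ⟩
  (I₀ *S (oneS -S qPow 1)) *S (Iⱼ *S (oneS -S Q))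
    ≈⟨ *-cong (invOneMinusQPow-inverse 0) (invOneMinusQPow-inverse j) ⟩
  oneS *S oneS
    ≈⟨ *-identityˡ oneS ⟩
  oneS ∎
  where
  open ≈-Reasoning
  I₀ = invOneMinusQPow 0
  Iⱼ = invOneMinusQPow j
  Q = qPow (suc j)

prodS-suc : ∀ k f → prodS (suc k) f ≈ f 0 *S prodS k (f ∘ suc)
prodS-suc zero    f = *-comm oneS (f 0)
prodS-suc (suc k) f = begin
  prodS (suc k) f *S f (suc k)             ≈⟨ *S-congʳ (f (suc k)) (prodS-suc k f) ⟩
  (f 0 *S prodS k (f ∘ suc)) *S f (suc k)  ≈⟨ *-assoc (f 0) (prodS k (f ∘ suc)) (f (suc k)) ⟩
  f 0 *S prodS (suc k) (f ∘ suc)           ∎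
  where open ≈-Reasoning

prodS-cong : ∀ k {f g} → (∀ i → f i ≈ g i) → prodS k f ≈ prodS k g
prodS-cong zero    f≈g = ≈-refl
prodS-cong (suc k) f≈g = *-cong (prodS-cong k f≈g) (f≈g k)

prodS-*-distrib : ∀ k f g → prodS k f *S prodS k g ≈ prodS k (λ i → f i *S g i)
prodS-*-distrib zero    f g = *-identityˡ oneS
prodS-*-distrib (suc k) f g = begin
  (prodS k f *S f k) *S (prodS k g *S g k)
    ≈⟨ solve 4 (λ F a G b → (F :* a) :* (G :* b) := (F :* G) :* (a :* b)) (λ _ → refl) (prodS k f) (f k) (prodS k g) (g k) ⟩
  (prodS k f *S prodS k g) *S (f k *S g k)
    ≈⟨ *S-congʳ (f k *S g k) (prodS-*-distrib k f g) ⟩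
  prodS k (λ i → f i *S g i) *S (f k *S g k) ∎
  where open ≈-Reasoning

prodS-oneS : ∀ k → prodS k (λ _ → oneS) ≈ oneS
prodS-oneS zero    = ≈-refl
prodS-oneS (suc k) = ≈-trans (*S-congʳ oneS (prodS-oneS k)) (*-identityˡ oneS)

prodS-zero : ∀ k f {i} → i < k → f i ≈ zeroS → prodS k f ≈ zeroS
prodS-zero (suc k) f {i} i<1+k fᵢ≈0 with ℕₚ.m<1+n⇒m<n∨m≡n i<1+k
... | inj₂ refl = ≈-trans (*S-congˡ (prodS k f) fᵢ≈0) (zeroʳ (prodS k f))
... | inj₁ i<k  = ≈-trans (*S-congʳ (f k) (prodS-zero k f i<k fᵢ≈0)) (zeroˡ (f k))

-- Gaussian polynomials

gaussian : ℕ → ℕ → Series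
gaussian m       zero    = oneS
gaussian zero    (suc k) = zeroS
gaussian (suc m) (suc k) = gaussian m k +S qPow (suc k) *S gaussian m (suc k)

gaussian-vanish : ∀ {m k} → m < k → gaussian m k ≈ zeroS
gaussian-vanish {zero}  {suc k} _           = ≈-refl
gaussian-vanish {suc m} {suc k} (s≤s m<k) = begin
  gaussian m k +S qPow (suc k) *S gaussian m (suc k)
    ≈⟨ +-cong (gaussian-vanish m<k) (*S-congˡ (qPow (suc k)) (gaussian-vanish (ℕₚ.m<n⇒m<1+n m<k))) ⟩
  zeroS +S qPow (suc k) *S zeroS   ≈⟨ +-identityˡ _ ⟩
  qPow (suc k) *S zeroS            ≈⟨ zeroʳ (qPow (suc k)) ⟩
  zeroS                            ∎
  where open ≈-Reasoning

qFactorial : ℕ → Series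
qFactorial k = prodS k (λ j → qInt (suc j))

qFalling : ℕ → ℕ → Series
qFalling m k = prodS k (λ i → qInt (m ∸ i))

qFalling-vanish : ∀ {m k} → m < k → qFalling m k ≈ zeroS
qFalling-vanish {m} m<k = prodS-zero _ (λ i → qInt (m ∸ i)) m<k (≈-trans (≈-reflexive (cong qInt (ℕₚ.n∸n≡0 m))) qInt-zero)

qFalling-*-qInt : ∀ m k → qFalling m k *S (qInt (suc k) +S qPow (suc k) *S qInt (m ∸ k)) ≈ qFalling m k *S qInt (suc m)
qFalling-*-qInt m k with k ℕ.≤? m
... | yes k≤m = *S-congˡ (qFalling m k)
                  (≈-trans (qInt-+ (suc k) (m ∸ k)) (≈-reflexive (cong (qInt ∘ suc) (ℕₚ.m+[n∸m]≡n k≤m))))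
... | no  k≰m = *S-irrelevantʳ (qFalling m k) (qInt (suc k) +S qPow (suc k) *S qInt (m ∸ k)) (qInt (suc m))
                               (qFalling-vanish (ℕₚ.≰⇒> k≰m))

qFactorial-*-gaussian : ∀ m k → qFactorial k *S gaussian m k ≈ qFalling m k
qFactorial-*-gaussian m       zero    = *-identityˡ oneS
qFactorial-*-gaussian zero    (suc k) = ≈-trans (zeroʳ (qFactorial (suc k))) (≈-sym (qFalling-vanish {0} {suc k} (s≤s z≤n)))
qFactorial-*-gaussian (suc m) (suc k) = begin
  (F *S [k+1]) *S (gaussian m k +S Q *S gaussian m (suc k))
    ≈⟨ solve 5 (λ F a g Q g′ → (F :* a) :* (g :+ Q :* g′) := a :* (F :* g) :+ Q :* ((F :* a) :* g′))
               (λ _ → refl) F [k+1] (gaussian m k) Q (gaussian m (suc k)) ⟩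
  [k+1] *S (F *S gaussian m k) +S Q *S ((F *S [k+1]) *S gaussian m (suc k))
    ≈⟨ +-cong (*S-congˡ [k+1] (qFactorial-*-gaussian m k)) (*S-congˡ Q (qFactorial-*-gaussian m (suc k))) ⟩
  [k+1] *S Fm +S Q *S (Fm *S qInt (m ∸ k))
    ≈⟨ solve 4 (λ a F Q b → a :* F :+ Q :* (F :* b) := F :* (a :+ Q :* b)) (λ _ → refl) [k+1] Fm Q (qInt (m ∸ k)) ⟩
  Fm *S ([k+1] +S Q *S qInt (m ∸ k))
    ≈⟨ qFalling-*-qInt m k ⟩
  Fm *S qInt (suc m)
    ≈⟨ *-comm Fm (qInt (suc m)) ⟩
  qInt (suc m) *S Fm
    ≈⟨ ≈-sym (prodS-suc k (λ i → qInt (suc m ∸ i))) ⟩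
  qFalling (suc m) (suc k) ∎
  where
  open ≈-Reasoning
  F = qFactorial k
  Fm = qFalling m k
  [k+1] = qInt (suc k)
  Q = qPow (suc k)

qBinom≈gaussian : ∀ m k → qBinom m k ≈ gaussian m k
qBinom≈gaussian m k = begin
  qFalling m k *S I                            ≈⟨ *S-congʳ I (≈-sym (qFactorial-*-gaussian m k)) ⟩
  (qFactorial k *S gaussian m k) *S I          ≈⟨ solve 3 (λ F g I → (F :* g) :* I := g :* (F :* I)) (λ _ → refl) (qFactorial k) (gaussian m k) I ⟩
  gaussian m k *S (qFactorial k *S I)          ≈⟨ *S-congˡ (gaussian m k) (prodS-*-distrib k (λ j → qInt (suc j)) invQInt) ⟩
  gaussian m k *S prodS k (λ j → qInt (suc j) *S invQInt j)
                                               ≈⟨ *S-congˡ (gaussian m k) (≈-trans (prodS-cong k qInt-inverse) (prodS-oneS k)) ⟩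
  gaussian m k *S oneS                         ≈⟨ *-identityʳ (gaussian m k) ⟩
  gaussian m k                                 ∎
  where
  open ≈-Reasoning
  I = prodS k invQInt

-- Exponents only need to agree where the Gaussian polynomial is nonzero.
gaussian-*S-qPow-≡ : ∀ m k a b c d → (k ≤ m → a + b ≡ c + d) →
  gaussian m k *S (qPow a *S qPow b) ≈ gaussian m k *S (qPow c *S qPow d)
gaussian-*S-qPow-≡ m k a b c d eq with k ℕ.≤? m
... | yes k≤m = *S-congˡ (gaussian m k) (qPow-*S-qPow-≡ a b c d (eq k≤m))
... | no  k≰m = *S-irrelevantʳ (gaussian m k) (qPow a *S qPow b) (qPow c *S qPow d) (gaussian-vanish (ℕₚ.≰⇒> k≰m))

gaussian-pascal′ : ∀ m k → gaussian (suc m) (suc k) ≈ qPow (m ∸ k) *S gaussian m k +S gaussian m (suc k)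
gaussian-pascal′ zero zero = begin
  oneS +S qPow 1 *S zeroS   ≈⟨ +S-congˡ oneS (zeroʳ (qPow 1)) ⟩
  oneS +S zeroS             ≈⟨ +S-congʳ zeroS (≈-sym (≈-trans (*-identityʳ (qPow 0)) qPow-zero)) ⟩
  qPow 0 *S oneS +S zeroS   ∎
  where open ≈-Reasoning
gaussian-pascal′ zero (suc k) = begin
  zeroS +S qPow (2 + k) *S zeroS   ≈⟨ +S-congˡ zeroS (zeroʳ (qPow (2 + k))) ⟩
  zeroS +S zeroS                   ≈⟨ +S-congʳ zeroS (≈-sym (zeroʳ (qPow 0))) ⟩
  qPow 0 *S zeroS +S zeroS         ∎
  where open ≈-Reasoning
gaussian-pascal′ (suc m) zero = begin
  oneS +S qPow 1 *S gaussian (suc m) 1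
    ≈⟨ +S-congˡ oneS (*S-congˡ (qPow 1) (gaussian-pascal′ m zero)) ⟩
  oneS +S qPow 1 *S (qPow m *S oneS +S gaussian m 1)
    ≈⟨ solve 4 (λ o q a g → o :+ q :* (a :* o :+ g) := (q :* a) :* o :+ (o :+ q :* g))
               (λ _ → refl) oneS (qPow 1) (qPow m) (gaussian m 1) ⟩
  (qPow 1 *S qPow m) *S oneS +S (oneS +S qPow 1 *S gaussian m 1)
    ≈⟨ +S-congʳ (oneS +S qPow 1 *S gaussian m 1) (*S-congʳ oneS (qPow-+ 1 m)) ⟩
  qPow (suc m) *S oneS +S (oneS +S qPow 1 *S gaussian m 1) ∎
  where open ≈-Reasoning
gaussian-pascal′ (suc m) (suc k) = begin
  gaussian (suc m) (suc k) +S B *S gaussian (suc m) (2 + k)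
    ≈⟨ +-cong (gaussian-pascal′ m k) (*S-congˡ B (gaussian-pascal′ m (suc k))) ⟩
  (A *S G₀ +S G₁) +S B *S (C *S G₁ +S G₂)
    ≈⟨ solve 6 (λ A G₀ G₁ B C G₂ → (A :* G₀ :+ G₁) :+ B :* (C :* G₁ :+ G₂) := A :* G₀ :+ G₁ :+ B :* G₂ :+ G₁ :* (B :* C))
               (λ _ → refl) A G₀ G₁ B C G₂ ⟩
  A *S G₀ +S G₁ +S B *S G₂ +S G₁ *S (B *S C)
    ≈⟨ +S-congˡ (A *S G₀ +S G₁ +S B *S G₂) (gaussian-*S-qPow-≡ m (suc k) (2 + k) (m ∸ suc k) (m ∸ k) (suc k) exponents) ⟩
  A *S G₀ +S G₁ +S B *S G₂ +S G₁ *S (A *S D)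
    ≈⟨ solve 6 (λ A G₀ G₁ B G₂ D → A :* G₀ :+ G₁ :+ B :* G₂ :+ G₁ :* (A :* D) := A :* (G₀ :+ D :* G₁) :+ (G₁ :+ B :* G₂))
               (λ _ → refl) A G₀ G₁ B G₂ D ⟩
  A *S (G₀ +S D *S G₁) +S (G₁ +S B *S G₂) ∎
  where
  open ≈-Reasoning
  A = qPow (m ∸ k)
  B = qPow (2 + k)
  C = qPow (m ∸ suc k)
  D = qPow (suc k)
  G₀ = gaussian m k
  G₁ = gaussian m (suc k)
  G₂ = gaussian m (2 + k)
  exponents : suc k ≤ m → 2 + k + (m ∸ suc k) ≡ m ∸ k + suc k
  exponents 1+k≤m = trans (cong suc (ℕₚ.m+[n∸m]≡n 1+k≤m))
    (sym (trans (ℕₚ.+-suc (m ∸ k) k) (cong suc (ℕₚ.m∸n+n≡m (ℕₚ.<⇒≤ 1+k≤m)))))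

-- The sums S and T

sumS-cong : ∀ n {f g} → (∀ k → k < n → f k ≈ g k) → sumS n f ≈ sumS n g
sumS-cong zero    f≈g = ≈-refl
sumS-cong (suc n) f≈g = +-cong (sumS-cong n (λ k k<n → f≈g k (ℕₚ.m<n⇒m<1+n k<n))) (f≈g n ℕₚ.≤-refl)

sumS-suc : ∀ n f → sumS (suc n) f ≈ f 0 +S sumS n (f ∘ suc)
sumS-suc zero    f = +-comm zeroS (f 0)
sumS-suc (suc n) f = ≈-trans (+S-congʳ (f (suc n)) (sumS-suc n f)) (+-assoc (f 0) (sumS n (f ∘ suc)) (f (suc n)))

sumS-distrib-− : ∀ n f g → sumS n (λ k → f k -S g k) ≈ sumS n f -S sumS n g
sumS-distrib-− zero    f g i = refl
sumS-distrib-− (suc n) f g = begin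
  sumS n (λ k → f k -S g k) +S (f n -S g n)   ≈⟨ +S-congʳ (f n -S g n) (sumS-distrib-− n f g) ⟩
  (sumS n f -S sumS n g) +S (f n -S g n)      ≈⟨ solve 4 (λ a b c d → (a :- b) :+ (c :- d) := (a :+ c) :- (b :+ d))
                                                           (λ _ → refl) (sumS n f) (sumS n g) (f n) (g n) ⟩
  (sumS n f +S f n) -S (sumS n g +S g n)      ∎
  where open ≈-Reasoning

*-distribˡ-sumS : ∀ n c f → c *S sumS n f ≈ sumS n (λ k → c *S f k)
*-distribˡ-sumS zero    c f = zeroʳ c
*-distribˡ-sumS (suc n) c f =
  ≈-trans (distribˡ c (sumS n f) (f n)) (+S-congʳ (c *S f n) (*-distribˡ-sumS n c f))

sumS-last-vanish : ∀ n f → f n ≈ zeroS → sumS (suc n) f ≈ sumS n f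
sumS-last-vanish n f fₙ≈0 = ≈-trans (+S-congˡ (sumS n f) fₙ≈0) (+-identityʳ (sumS n f))

sumS-extend : ∀ d n f → (∀ k → n ≤ k → f k ≈ zeroS) → sumS n f ≈ sumS (d + n) f
sumS-extend zero    n f f≈0 = ≈-refl
sumS-extend (suc d) n f f≈0 = ≈-trans (sumS-extend d n f f≈0)
  (≈-sym (sumS-last-vanish (d + n) f (f≈0 (d + n) (ℕₚ.m≤n+m n d))))

triangular : ℕ → ℕ
triangular zero    = 0
triangular (suc k) = triangular k + k

triangular-suc-*2 : ∀ k → triangular (suc k) * 2 ≡ suc k * k
triangular-suc-*2 zero    = refl
triangular-suc-*2 (suc k) = begin
  (triangular (suc k) + suc k) * 2       ≡⟨ ℕₚ.*-distribʳ-+ 2 (triangular (suc k)) (suc k) ⟩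
  triangular (suc k) * 2 + suc k * 2     ≡⟨ cong (_+ suc k * 2) (triangular-suc-*2 k) ⟩
  suc k * k + suc k * 2                  ≡⟨ solveℕ (k ∷ []) ⟩
  suc (suc k) * suc k                    ∎
  where open ≡-Reasoning

k*[k∸1]/2≡triangular : ∀ k → k * (k ∸ 1) / 2 ≡ triangular k
k*[k∸1]/2≡triangular zero    = refl
k*[k∸1]/2≡triangular (suc k) = trans (cong (_/ 2) (sym (triangular-suc-*2 k))) (ℕ.m*n/n≡m (triangular (suc k)) 2)

term : ℕ → ℕ → Series
term n k = signS k *S gaussian (n ∸ k) k *S qPow (triangular k)

T : ℕ → Series
T n = sumS (suc n) (term n)

S′ : ℕ → Series
S′ n = sumS (suc n) (λ k → term n k *S qPow (n ∸ k))

term-vanish : ∀ n k → n ∸ k < k → term n k ≈ zeroS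
term-vanish n k n∸k<k = begin
  signS k *S gaussian (n ∸ k) k *S qPow (triangular k)
    ≈⟨ *S-congʳ (qPow (triangular k)) (*S-congˡ (signS k) (gaussian-vanish n∸k<k)) ⟩
  signS k *S zeroS *S qPow (triangular k)  ≈⟨ *S-congʳ (qPow (triangular k)) (zeroʳ (signS k)) ⟩
  zeroS *S qPow (triangular k)             ≈⟨ zeroˡ (qPow (triangular k)) ⟩
  zeroS                                    ∎
  where open ≈-Reasoning

term-pascal′ : ∀ m j → j ≤ m → term (2 + m) (suc j) ≈ term (suc m) (suc j) -S term m j *S qPow (m ∸ j)
term-pascal′ m j j≤m rewrite ℕₚ.+-∸-assoc 1 j≤m = begin
  (-S s) *S gaussian (suc M) (suc j) *S T₁
    ≈⟨ *S-congʳ T₁ (*S-congˡ (-S s) (gaussian-pascal′ M j)) ⟩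
  (-S s) *S (E *S G₀ +S G₁) *S T₁
    ≈⟨ solve 5 (λ s E G₀ G₁ T₁ → (:- s) :* (E :* G₀ :+ G₁) :* T₁ := (:- s) :* G₁ :* T₁ :- s :* (G₀ :* (E :* T₁)))
               (λ _ → refl) s E G₀ G₁ T₁ ⟩
  (-S s) *S G₁ *S T₁ -S s *S (G₀ *S (E *S T₁))
    ≈⟨ +S-congˡ ((-S s) *S G₁ *S T₁) (-S-cong (*S-congˡ s
         (gaussian-*S-qPow-≡ M j (M ∸ j) (triangular j + j) (triangular j) M exponents))) ⟩
  (-S s) *S G₁ *S T₁ -S s *S (G₀ *S (T₀ *S R))
    ≈⟨ solve 6 (λ s T₀ G₀ G₁ T₁ R → (:- s) :* G₁ :* T₁ :- s :* (G₀ :* (T₀ :* R)) := (:- s) :* G₁ :* T₁ :- s :* G₀ :* T₀ :* R)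
               (λ _ → refl) s T₀ G₀ G₁ T₁ R ⟩
  (-S s) *S G₁ *S T₁ -S s *S G₀ *S T₀ *S R ∎
  where
  open ≈-Reasoning
  s = signS j
  M = m ∸ j
  G₀ = gaussian M j
  G₁ = gaussian M (suc j)
  E = qPow (M ∸ j)
  T₀ = qPow (triangular j)
  T₁ = qPow (triangular j + j)
  R = qPow M
  exponents : j ≤ M → M ∸ j + (triangular j + j) ≡ triangular j + M
  exponents j≤M = trans (swap (M ∸ j) (triangular j) j) (cong (triangular j +_) (ℕₚ.m∸n+n≡m j≤M))
    where
    swap : ∀ x t j → x + (t + j) ≡ t + (x + j)
    swap = solve-∀

term-pascal : ∀ m j → j ≤ m →
  term (2 + m) (suc j) *S qPow (suc m ∸ j) ≈ qPow (2 + m) *S term (suc m) (suc j) -S qPow (suc m) *S term m j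
term-pascal m j j≤m rewrite ℕₚ.+-∸-assoc 1 j≤m = begin
  (-S s) *S (G₀ +S D *S G₁) *S T₁ *S W
    ≈⟨ solve 6 (λ s G₀ D G₁ T₁ W → (:- s) :* (G₀ :+ D :* G₁) :* T₁ :* W
                                    := (:- s) :* G₀ :* (T₁ :* W) :+ (:- s) :* G₁ :* (D :* (T₁ :* W)))
               (λ _ → refl) s G₀ D G₁ T₁ W ⟩
  (-S s) *S G₀ *S (T₁ *S W) +S (-S s) *S G₁ *S (D *S (T₁ *S W))
    ≈⟨ +-cong (*S-congˡ ((-S s) *S G₀) T₁W≈X) (*S-congˡ ((-S s) *S G₁) (*S-congˡ D T₁W≈X)) ⟩
  (-S s) *S G₀ *S X +S (-S s) *S G₁ *S (D *S X)
    ≈⟨ +-cong (*S-congˡ ((-S s) *S G₀) (≈-sym (qPow-+ (suc m) (triangular j))))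
              (*S-congˡ ((-S s) *S G₁) (qPow-*S-qPow-≡ (suc j) (suc m + triangular j) (2 + m) (triangular j + j) (reorder m (triangular j) j))) ⟩
  (-S s) *S G₀ *S (Q₁ *S T₀) +S (-S s) *S G₁ *S (Q₂ *S T₁)
    ≈⟨ solve 7 (λ s G₀ G₁ Q₁ Q₂ T₀ T₁ → (:- s) :* G₀ :* (Q₁ :* T₀) :+ (:- s) :* G₁ :* (Q₂ :* T₁)
                                         := Q₂ :* ((:- s) :* G₁ :* T₁) :- Q₁ :* (s :* G₀ :* T₀))
               (λ _ → refl) s G₀ G₁ Q₁ Q₂ T₀ T₁ ⟩
  Q₂ *S ((-S s) *S G₁ *S T₁) -S Q₁ *S (s *S G₀ *S T₀) ∎
  where
  open ≈-Reasoning
  s = signS j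
  M = m ∸ j
  G₀ = gaussian M j
  G₁ = gaussian M (suc j)
  D = qPow (suc j)
  T₀ = qPow (triangular j)
  T₁ = qPow (triangular j + j)
  W = qPow (suc M)
  Q₁ = qPow (suc m)
  Q₂ = qPow (2 + m)
  X = qPow (suc m + triangular j)
  reorder : ∀ m t j → suc j + (suc m + t) ≡ 2 + m + (t + j)
  reorder = solve-∀
  T₁W≈X : T₁ *S W ≈ X
  T₁W≈X = ≈-trans (qPow-+ (triangular j + j) (suc M))
    (≈-reflexive (cong qPow (trans (regroup (triangular j) j M) (cong (λ n → suc n + triangular j) (ℕₚ.m+[n∸m]≡n j≤m)))))
    where
    regroup : ∀ t j M → t + j + suc M ≡ suc (j + M) + t
    regroup = solve-∀

term-diagonal-vanish : ∀ n → term (suc n) (suc n) ≈ zeroS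
term-diagonal-vanish n = term-vanish (suc n) (suc n) (s≤s (ℕₚ.m∸n≤m n n))

T-rec : ∀ m → T (2 + m) ≈ T (suc m) -S S′ m
T-rec m = begin
  T (2 + m)
    ≈⟨ sumS-suc (2 + m) (term (2 + m)) ⟩
  t₀ +S sumS (2 + m) (λ j → term (2 + m) (suc j))
    ≈⟨ +S-congˡ t₀ (sumS-last-vanish (suc m) (λ j → term (2 + m) (suc j)) (term-diagonal-vanish (suc m))) ⟩
  t₀ +S sumS (suc m) (λ j → term (2 + m) (suc j))
    ≈⟨ +S-congˡ t₀ (sumS-cong (suc m) (λ j j<1+m → term-pascal′ m j (ℕₚ.≤-pred j<1+m))) ⟩
  t₀ +S sumS (suc m) (λ j → term (suc m) (suc j) -S term m j *S qPow (m ∸ j))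
    ≈⟨ +S-congˡ t₀ (sumS-distrib-− (suc m) (λ j → term (suc m) (suc j)) (λ j → term m j *S qPow (m ∸ j))) ⟩
  t₀ +S (Σ₁ -S S′ m)
    ≈⟨ solve 3 (λ t Σ S → t :+ (Σ :- S) := (t :+ Σ) :- S) (λ _ → refl) t₀ Σ₁ (S′ m) ⟩
  (t₀ +S Σ₁) -S S′ m
    ≈⟨ +S-congʳ (-S S′ m) (≈-sym (sumS-suc (suc m) (term (suc m)))) ⟩
  T (suc m) -S S′ m ∎
  where
  open ≈-Reasoning
  t₀ = term 0 0
  Σ₁ = sumS (suc m) (λ j → term (suc m) (suc j))

S′-rec : ∀ m → S′ (2 + m) ≈ qPow (2 + m) *S T (suc m) -S qPow (suc m) *S T m
S′-rec m = begin
  S′ (2 + m)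
    ≈⟨ sumS-suc (2 + m) (λ k → term (2 + m) k *S qPow (2 + m ∸ k)) ⟩
  t₀ *S Q₂ +S sumS (2 + m) (λ j → term (2 + m) (suc j) *S qPow (suc m ∸ j))
    ≈⟨ +S-congˡ (t₀ *S Q₂) (sumS-last-vanish (suc m) (λ j → term (2 + m) (suc j) *S qPow (suc m ∸ j))
         (≈-trans (*S-congʳ (qPow (m ∸ m)) (term-diagonal-vanish (suc m))) (zeroˡ (qPow (m ∸ m))))) ⟩
  t₀ *S Q₂ +S sumS (suc m) (λ j → term (2 + m) (suc j) *S qPow (suc m ∸ j))
    ≈⟨ +S-congˡ (t₀ *S Q₂) (sumS-cong (suc m) (λ j j<1+m → term-pascal m j (ℕₚ.≤-pred j<1+m))) ⟩
  t₀ *S Q₂ +S sumS (suc m) (λ j → Q₂ *S term (suc m) (suc j) -S Q₁ *S term m j)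
    ≈⟨ +S-congˡ (t₀ *S Q₂) (sumS-distrib-− (suc m) (λ j → Q₂ *S term (suc m) (suc j)) (λ j → Q₁ *S term m j)) ⟩
  t₀ *S Q₂ +S (sumS (suc m) (λ j → Q₂ *S term (suc m) (suc j)) -S sumS (suc m) (λ j → Q₁ *S term m j))
    ≈⟨ +S-congˡ (t₀ *S Q₂) (≈-sym (+-cong (*-distribˡ-sumS (suc m) Q₂ (λ j → term (suc m) (suc j)))
                                           (-S-cong (*-distribˡ-sumS (suc m) Q₁ (term m))))) ⟩
  t₀ *S Q₂ +S (Q₂ *S Σ₁ -S Q₁ *S T m)
    ≈⟨ solve 5 (λ t Q₂ Σ Q₁ T → t :* Q₂ :+ (Q₂ :* Σ :- Q₁ :* T) := Q₂ :* (t :+ Σ) :- Q₁ :* T)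
               (λ _ → refl) t₀ Q₂ Σ₁ Q₁ (T m) ⟩
  Q₂ *S (t₀ +S Σ₁) -S Q₁ *S T m
    ≈⟨ +S-congʳ (-S (Q₁ *S T m)) (*S-congˡ Q₂ (≈-sym (sumS-suc (suc m) (term (suc m))))) ⟩
  Q₂ *S T (suc m) -S Q₁ *S T m ∎
  where
  open ≈-Reasoning
  t₀ = term 0 0
  Q₁ = qPow (suc m)
  Q₂ = qPow (2 + m)
  Σ₁ = sumS (suc m) (λ j → term (suc m) (suc j))

n/2<k⇒n∸k<k : ∀ n k → n / 2 < k → n ∸ k < k
n/2<k⇒n∸k<k n (suc k) n/2<1+k = ℕₚ.m<n+o⇒m∸n<o n (suc k) (ℕₚ.≰⇒> λ 2+2k≤n →
  ℕₚ.<⇒≱ n/2<1+k (subst (_≤ n / 2) (ℕ.m*n/n≡m (suc k) 2) (ℕ./-monoˡ-≤ 2 (subst (_≤ n) (double (suc k)) 2+2k≤n))))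
  where
  double : ∀ m → m + m ≡ m * 2
  double = solve-∀

-- Terms with k > n / 2 vanish, so the sum may be extended up to k = n.
S≈S′ : ∀ n → S n ≈ S′ n
S≈S′ n = begin
  S n
    ≈⟨ sumS-cong (suc (n / 2)) (λ k _ → summand k) ⟩
  sumS (suc (n / 2)) F
    ≈⟨ sumS-extend (n ∸ n / 2) (suc (n / 2)) F (λ k 1+n/2≤k →
         ≈-trans (*S-congʳ (qPow (n ∸ k)) (term-vanish n k (n/2<k⇒n∸k<k n k 1+n/2≤k))) (zeroˡ (qPow (n ∸ k)))) ⟩
  sumS (n ∸ n / 2 + suc (n / 2)) F
    ≈⟨ ≈-reflexive (cong (λ N → sumS N F) (trans (ℕₚ.+-suc (n ∸ n / 2) (n / 2)) (cong suc (ℕₚ.m∸n+n≡m (ℕ.m/n≤m n 2))))) ⟩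
  S′ n ∎
  where
  open ≈-Reasoning
  F = λ k → term n k *S qPow (n ∸ k)
  summand : ∀ k → signS k *S qBinom (n ∸ k) k *S qPow (k * (k ∸ 1) / 2) *S qPow (n ∸ k) ≈ F k
  summand k rewrite k*[k∸1]/2≡triangular k =
    *S-congʳ (qPow (n ∸ k)) (*S-congʳ (qPow (triangular k)) (*S-congˡ (signS k) (qBinom≈gaussian (n ∸ k) k)))

-- Closed forms modulo 3

term-zero : ∀ n → term n 0 ≈ oneS
term-zero n = ≈-trans (*S-congʳ (qPow 0) (*-identityˡ oneS)) (≈-trans (*-identityˡ (qPow 0)) qPow-zero)

T-zero : T 0 ≈ oneS
T-zero = ≈-trans (+-identityˡ (term 0 0)) (term-zero 0)

T-one : T 1 ≈ oneS
T-one = ≈-trans (sumS-last-vanish 1 (term 1) (term-diagonal-vanish 0)) T-zero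

S′-zero : S′ 0 ≈ oneS
S′-zero = ≈-trans (+-identityˡ (term 0 0 *S qPow 0))
  (≈-trans (*S-congˡ (term 0 0) qPow-zero) (≈-trans (*-identityʳ (term 0 0)) (term-zero 0)))

S′-one : S′ 1 ≈ qPow 1
S′-one = begin
  S′ 1
    ≈⟨ sumS-last-vanish 1 (λ k → term 1 k *S qPow (1 ∸ k))
                       (≈-trans (*S-congʳ (qPow 0) (term-diagonal-vanish 0)) (zeroˡ (qPow 0))) ⟩
  zeroS +S term 0 0 *S qPow 1  ≈⟨ +-identityˡ (term 0 0 *S qPow 1) ⟩
  term 0 0 *S qPow 1           ≈⟨ *S-congʳ (qPow 1) (term-zero 0) ⟩
  oneS *S qPow 1               ≈⟨ *-identityˡ (qPow 1) ⟩
  qPow 1                       ∎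
  where open ≈-Reasoning

T-step : ∀ n → T (3 + n) ≈ -S (qPow (suc n) *S T n)
T-step zero = begin
  T 3                              ≈⟨ ≈-trans (T-rec 1) (+S-congʳ (-S S′ 1) (T-rec 0)) ⟩
  (T 1 -S S′ 0) -S S′ 1            ≈⟨ +-cong (+-cong T-one (-S-cong S′-zero)) (-S-cong S′-one) ⟩
  (oneS -S oneS) -S qPow 1         ≈⟨ +S-congʳ (-S qPow 1) (-‿inverseʳ oneS) ⟩
  zeroS -S qPow 1                  ≈⟨ +-identityˡ (-S qPow 1) ⟩
  -S qPow 1                        ≈⟨ -S-cong (≈-sym (≈-trans (*S-congˡ (qPow 1) T-zero) (*-identityʳ (qPow 1)))) ⟩
  -S (qPow 1 *S T 0)               ∎
  where open ≈-Reasoning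
T-step (suc n) = begin
  T (4 + n)
    ≈⟨ T-rec (2 + n) ⟩
  T (3 + n) -S S′ (2 + n)
    ≈⟨ +-cong (T-step n) (-S-cong (S′-rec n)) ⟩
  -S (Q₁ *S T n) -S (Q₂ *S T (suc n) -S Q₁ *S T n)
    ≈⟨ solve 4 (λ Q₁ Q₂ T₀ T₁ → :- (Q₁ :* T₀) :- (Q₂ :* T₁ :- Q₁ :* T₀) := :- (Q₂ :* T₁))
               (λ _ → refl) Q₁ Q₂ (T n) (T (suc n)) ⟩
  -S (Q₂ *S T (suc n)) ∎
  where
  open ≈-Reasoning
  Q₁ = qPow (suc n)
  Q₂ = qPow (2 + n)

pentagonal : ℕ → ℕ
pentagonal zero    = 0
pentagonal (suc t) = pentagonal t + suc (t * 3)

pentagonal′ : ℕ → ℕ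
pentagonal′ t = pentagonal t + t

pentagonal′-suc : ∀ t → pentagonal′ t + (2 + t * 3) ≡ pentagonal′ (suc t)
pentagonal′-suc t = regroup (pentagonal t) t
  where
  regroup : ∀ p t → p + t + (2 + t * 3) ≡ p + suc (t * 3) + suc t
  regroup = solve-∀

qPow-*S-scaled : ∀ a s b → qPow a *S (s *S qPow b) ≈ s *S qPow (b + a)
qPow-*S-scaled a s b = ≈-trans (solve 3 (λ A s B → A :* (s :* B) := s :* (B :* A)) (λ _ → refl) (qPow a) s (qPow b))
                               (*S-congˡ s (qPow-+ b a))

-S-qPow-*S-scaled : ∀ a s b → -S (qPow a *S (s *S qPow b)) ≈ (-S s) *S qPow (b + a)
-S-qPow-*S-scaled a s b = ≈-trans (-S-cong (qPow-*S-scaled a s b)) (-‿distribˡ-* s (qPow (b + a)))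

T-closed₀ : ∀ t → T (t * 3) ≈ signS t *S qPow (pentagonal t)
T-closed₀ zero    = ≈-trans T-zero (≈-sym (≈-trans (*-identityˡ (qPow 0)) qPow-zero))
T-closed₀ (suc t) = ≈-trans (T-step (t * 3))
  (≈-trans (-S-cong (*S-congˡ (qPow (suc (t * 3))) (T-closed₀ t)))
           (-S-qPow-*S-scaled (suc (t * 3)) (signS t) (pentagonal t)))

T-closed₁ : ∀ t → T (1 + t * 3) ≈ signS t *S qPow (pentagonal′ t)
T-closed₁ zero    = ≈-trans T-one (≈-sym (≈-trans (*-identityˡ (qPow 0)) qPow-zero))
T-closed₁ (suc t) = ≈-trans (T-step (1 + t * 3))
  (≈-trans (-S-cong (*S-congˡ (qPow (2 + t * 3)) (T-closed₁ t)))
  (≈-trans (-S-qPow-*S-scaled (2 + t * 3) (signS t) (pentagonal′ t))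
           (*S-congˡ (-S signS t) (≈-reflexive (cong qPow (pentagonal′-suc t))))))

T-closed₂ : ∀ t → T (2 + t * 3) ≈ zeroS
T-closed₂ zero    = ≈-trans (T-rec 0) (≈-trans (+-cong T-one (-S-cong S′-zero)) (-‿inverseʳ oneS))
T-closed₂ (suc t) = ≈-trans (T-step (2 + t * 3))
  (≈-trans (-S-cong (*S-congˡ (qPow (3 + t * 3)) (T-closed₂ t)))
           (≈-trans (-S-cong (zeroʳ (qPow (3 + t * 3)))) -0#≈0#))

S-closed₀ : ∀ t → S (t * 3) ≈ signS t *S qPow (pentagonal′ t)
S-closed₀ zero    = ≈-trans (S≈S′ 0) (≈-trans S′-zero (≈-sym (≈-trans (*-identityˡ (qPow 0)) qPow-zero)))
S-closed₀ (suc t) = begin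
  S (3 + t * 3)
    ≈⟨ ≈-trans (S≈S′ (3 + t * 3)) (S′-rec (suc (t * 3))) ⟩
  qPow (3 + t * 3) *S T (2 + t * 3) -S qPow (2 + t * 3) *S T (1 + t * 3)
    ≈⟨ +-cong (≈-trans (*S-congˡ (qPow (3 + t * 3)) (T-closed₂ t)) (zeroʳ (qPow (3 + t * 3))))
              (-S-cong (*S-congˡ (qPow (2 + t * 3)) (T-closed₁ t))) ⟩
  zeroS -S qPow (2 + t * 3) *S (signS t *S qPow (pentagonal′ t))
    ≈⟨ +-identityˡ _ ⟩
  -S (qPow (2 + t * 3) *S (signS t *S qPow (pentagonal′ t)))
    ≈⟨ -S-qPow-*S-scaled (2 + t * 3) (signS t) (pentagonal′ t) ⟩
  (-S signS t) *S qPow (pentagonal′ t + (2 + t * 3))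
    ≈⟨ *S-congˡ (-S signS t) (≈-reflexive (cong qPow (pentagonal′-suc t))) ⟩
  (-S signS t) *S qPow (pentagonal′ (suc t)) ∎
  where open ≈-Reasoning

S-closed₁ : ∀ t → S (1 + t * 3) ≈ signS t *S qPow (pentagonal (suc t))
S-closed₁ zero    = ≈-trans (S≈S′ 1) (≈-trans S′-one (≈-sym (*-identityˡ (qPow 1))))
S-closed₁ (suc t) = begin
  S (4 + t * 3)
    ≈⟨ ≈-trans (S≈S′ (4 + t * 3)) (S′-rec (2 + t * 3)) ⟩
  qPow (4 + t * 3) *S T (3 + t * 3) -S qPow (3 + t * 3) *S T (2 + t * 3)
    ≈⟨ +-cong (*S-congˡ (qPow (4 + t * 3)) (T-closed₀ (suc t)))
              (-S-cong (≈-trans (*S-congˡ (qPow (3 + t * 3)) (T-closed₂ t)) (zeroʳ (qPow (3 + t * 3))))) ⟩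
  qPow (4 + t * 3) *S ((-S signS t) *S qPow (pentagonal (suc t))) -S zeroS
    ≈⟨ +-identityʳ _ ⟩
  qPow (4 + t * 3) *S ((-S signS t) *S qPow (pentagonal (suc t)))
    ≈⟨ qPow-*S-scaled (4 + t * 3) (-S signS t) (pentagonal (suc t)) ⟩
  (-S signS t) *S qPow (pentagonal (2 + t)) ∎
  where open ≈-Reasoning

S-closed₂ : ∀ t → S (2 + t * 3) ≈ signS t *S (qPow (pentagonal′ (suc t)) -S qPow (pentagonal (suc t)))
S-closed₂ t = begin
  S (2 + t * 3)
    ≈⟨ ≈-trans (S≈S′ (2 + t * 3)) (S′-rec (t * 3)) ⟩
  qPow (2 + t * 3) *S T (1 + t * 3) -S qPow (1 + t * 3) *S T (t * 3)
    ≈⟨ +-cong (*S-congˡ (qPow (2 + t * 3)) (T-closed₁ t)) (-S-cong (*S-congˡ (qPow (1 + t * 3)) (T-closed₀ t))) ⟩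
  qPow (2 + t * 3) *S (s *S qPow (pentagonal′ t)) -S qPow (1 + t * 3) *S (s *S qPow (pentagonal t))
    ≈⟨ +-cong (qPow-*S-scaled (2 + t * 3) s (pentagonal′ t)) (-S-cong (qPow-*S-scaled (1 + t * 3) s (pentagonal t))) ⟩
  s *S qPow (pentagonal′ t + (2 + t * 3)) -S s *S qPow (pentagonal (suc t))
    ≈⟨ +S-congʳ (-S (s *S qPow (pentagonal (suc t)))) (*S-congˡ s (≈-reflexive (cong qPow (pentagonal′-suc t)))) ⟩
  s *S qPow (pentagonal′ (suc t)) -S s *S qPow (pentagonal (suc t))
    ≈⟨ solve 3 (λ s X Y → s :* X :- s :* Y := s :* (X :- Y)) (λ _ → refl)
               s (qPow (pentagonal′ (suc t))) (qPow (pentagonal (suc t))) ⟩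
  s *S (qPow (pentagonal′ (suc t)) -S qPow (pentagonal (suc t))) ∎
  where
  open ≈-Reasoning
  s = signS t

n≡r+t*3⇒n/3≡t : ∀ n r t → r < 3 → n ≡ r + t * 3 → n / 3 ≡ t
n≡r+t*3⇒n/3≡t _ r t r<3 refl = trans (ℕ.+-distrib-/-∣ʳ r (ℕ.n∣m*n t)) (cong₂ _+_ (ℕ.m<n⇒m/n≡0 r<3) (ℕ.m*n/n≡m t 3))

Recurrence : ℕ → Set
Recurrence n = S n ≈ qPow ((n + 2) / 3) *S S (n ∸ 1) -S qPow ((2 * n + 1) / 3) *S S (n ∸ 2)

recurrence-cong : ∀ {a a′ b b′ f f′ g g′} → a ≡ a′ → b ≡ b′ → f ≈ f′ → g ≈ g′ →
  qPow a *S f -S qPow b *S g ≈ qPow a′ *S f′ -S qPow b′ *S g′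
recurrence-cong {a} {b = b} refl refl f≈f′ g≈g′ = +-cong (*S-congˡ (qPow a) f≈f′) (-S-cong (*S-congˡ (qPow b) g≈g′))

recurrence₂ : ∀ t → Recurrence (2 + t * 3)
recurrence₂ t = ≈-sym (begin
  qPow ((2 + t * 3 + 2) / 3) *S S (1 + t * 3) -S qPow ((2 * (2 + t * 3) + 1) / 3) *S S (t * 3)
    ≈⟨ recurrence-cong floor₁ floor₂ (S-closed₁ t) (S-closed₀ t) ⟩
  qPow (suc t) *S (s *S qPow p₁) -S qPow (suc (t * 2)) *S (s *S qPow (pentagonal′ t))
    ≈⟨ +-cong (qPow-*S-scaled (suc t) s p₁) (-S-cong (qPow-*S-scaled (suc (t * 2)) s (pentagonal′ t))) ⟩
  s *S qPow (p₁ + suc t) -S s *S qPow (pentagonal′ t + suc (t * 2))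
    ≈⟨ +S-congˡ (s *S qPow (p₁ + suc t)) (-S-cong (*S-congˡ s (≈-reflexive (cong qPow (regroup (pentagonal t) t))))) ⟩
  s *S qPow (pentagonal′ (suc t)) -S s *S qPow p₁
    ≈⟨ solve 3 (λ s X Y → s :* X :- s :* Y := s :* (X :- Y)) (λ _ → refl) s (qPow (pentagonal′ (suc t))) (qPow p₁) ⟩
  s *S (qPow (pentagonal′ (suc t)) -S qPow p₁)
    ≈⟨ ≈-sym (S-closed₂ t) ⟩
  S (2 + t * 3) ∎)
  where
  open ≈-Reasoning
  s = signS t
  p₁ = pentagonal (suc t)
  floor₁ : (2 + t * 3 + 2) / 3 ≡ suc t
  floor₁ = n≡r+t*3⇒n/3≡t (2 + t * 3 + 2) 1 (suc t) (s≤s (s≤s z≤n)) (solveℕ (t ∷ []))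
  floor₂ : (2 * (2 + t * 3) + 1) / 3 ≡ suc (t * 2)
  floor₂ = n≡r+t*3⇒n/3≡t (2 * (2 + t * 3) + 1) 2 (suc (t * 2)) (s≤s (s≤s (s≤s z≤n))) (solveℕ (t ∷ []))
  regroup : ∀ p t → p + t + suc (t * 2) ≡ p + suc (t * 3)
  regroup = solve-∀

recurrence₃ : ∀ t → Recurrence (3 + t * 3)
recurrence₃ t = ≈-sym (begin
  qPow ((3 + t * 3 + 2) / 3) *S S (2 + t * 3) -S qPow ((2 * (3 + t * 3) + 1) / 3) *S S (1 + t * 3)
    ≈⟨ recurrence-cong floor₁ floor₂ (S-closed₂ t) (S-closed₁ t) ⟩
  A *S (s *S (X -S Y)) -S B *S (s *S Y)
    ≈⟨ solve 5 (λ s A B X Y → A :* (s :* (X :- Y)) :- B :* (s :* Y) := s :* (A :* X) :- s :* (A :* Y) :- s :* (B :* Y))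
               (λ _ → refl) s A B X Y ⟩
  s *S (A *S X) -S s *S (A *S Y) -S s *S (B *S Y)
    ≈⟨ +-cong (+-cong (*S-congˡ s (qPow-+ (suc t) p′₁))
                      (-S-cong (*S-congˡ s (qPow-+-≡ (suc t) p₁ p′₁ (ℕₚ.+-comm (suc t) p₁)))))
              (-S-cong (*S-congˡ s (qPow-+-≡ (2 + t * 2) p₁ (suc t + p′₁) (regroup p₁ t)))) ⟩
  s *S Z -S s *S X -S s *S Z
    ≈⟨ solve 3 (λ s X Z → s :* Z :- s :* X :- s :* Z := (:- s) :* X) (λ _ → refl) s X Z ⟩
  (-S s) *S X
    ≈⟨ ≈-sym (S-closed₀ (suc t)) ⟩
  S (3 + t * 3) ∎)
  where
  open ≈-Reasoning
  s = signS t
  p₁ = pentagonal (suc t)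
  p′₁ = pentagonal′ (suc t)
  A = qPow (suc t)
  B = qPow (2 + t * 2)
  X = qPow p′₁
  Y = qPow p₁
  Z = qPow (suc t + p′₁)
  floor₁ : (3 + t * 3 + 2) / 3 ≡ suc t
  floor₁ = n≡r+t*3⇒n/3≡t (3 + t * 3 + 2) 2 (suc t) (s≤s (s≤s (s≤s z≤n))) (solveℕ (t ∷ []))
  floor₂ : (2 * (3 + t * 3) + 1) / 3 ≡ 2 + t * 2
  floor₂ = n≡r+t*3⇒n/3≡t (2 * (3 + t * 3) + 1) 1 (2 + t * 2) (s≤s (s≤s z≤n)) (solveℕ (t ∷ []))
  regroup : ∀ p t → 2 + t * 2 + p ≡ suc t + (p + suc t)
  regroup = solve-∀

recurrence₄ : ∀ t → Recurrence (4 + t * 3)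
recurrence₄ t = ≈-sym (begin
  qPow ((4 + t * 3 + 2) / 3) *S S (3 + t * 3) -S qPow ((2 * (4 + t * 3) + 1) / 3) *S S (2 + t * 3)
    ≈⟨ recurrence-cong floor₁ floor₂ (S-closed₀ (suc t)) (S-closed₂ t) ⟩
  A *S ((-S s) *S X) -S B *S (s *S (X -S Y))
    ≈⟨ solve 5 (λ s A B X Y → A :* ((:- s) :* X) :- B :* (s :* (X :- Y)) := s :* (B :* Y) :- s :* (A :* X) :- s :* (B :* X))
               (λ _ → refl) s A B X Y ⟩
  s *S (B *S Y) -S s *S (A *S X) -S s *S (B *S X)
    ≈⟨ +-cong (+-cong (*S-congˡ s (qPow-+ (3 + t * 2) p₁))
                      (-S-cong (*S-congˡ s (qPow-+-≡ (2 + t) p′₁ (3 + t * 2 + p₁) (regroup₁ p₁ t)))))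
              (-S-cong (*S-congˡ s (qPow-+-≡ (3 + t * 2) p′₁ (pentagonal (2 + t)) (regroup₂ p₁ t)))) ⟩
  s *S Z -S s *S Z -S s *S qPow (pentagonal (2 + t))
    ≈⟨ solve 3 (λ s Z P → s :* Z :- s :* Z :- s :* P := (:- s) :* P) (λ _ → refl) s Z (qPow (pentagonal (2 + t))) ⟩
  (-S s) *S qPow (pentagonal (2 + t))
    ≈⟨ ≈-sym (S-closed₁ (suc t)) ⟩
  S (4 + t * 3) ∎)
  where
  open ≈-Reasoning
  s = signS t
  p₁ = pentagonal (suc t)
  p′₁ = pentagonal′ (suc t)
  A = qPow (2 + t)
  B = qPow (3 + t * 2)
  X = qPow p′₁
  Y = qPow p₁
  Z = qPow (3 + t * 2 + p₁)
  floor₁ : (4 + t * 3 + 2) / 3 ≡ 2 + t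
  floor₁ = n≡r+t*3⇒n/3≡t (4 + t * 3 + 2) 0 (2 + t) (s≤s z≤n) (solveℕ (t ∷ []))
  floor₂ : (2 * (4 + t * 3) + 1) / 3 ≡ 3 + t * 2
  floor₂ = n≡r+t*3⇒n/3≡t (2 * (4 + t * 3) + 1) 0 (3 + t * 2) (s≤s z≤n) (solveℕ (t ∷ []))
  regroup₁ : ∀ p t → 2 + t + (p + suc t) ≡ 3 + t * 2 + p
  regroup₁ = solve-∀
  regroup₂ : ∀ p t → 3 + t * 2 + (p + suc t) ≡ p + (4 + t * 3)
  regroup₂ = solve-∀

data Mod3 : ℕ → Set where
  0+3t : ∀ t → Mod3 (t * 3)
  1+3t : ∀ t → Mod3 (1 + t * 3)
  2+3t : ∀ t → Mod3 (2 + t * 3)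

mod3 : ∀ n → Mod3 n
mod3 zero = 0+3t 0
mod3 (suc n) with mod3 n
... | 0+3t t = 1+3t t
... | 1+3t t = 2+3t t
... | 2+3t t = 0+3t (suc t)

recurrence-mod3 : ∀ {m} → Mod3 m → Recurrence (2 + m)
recurrence-mod3 (0+3t t) = recurrence₂ t
recurrence-mod3 (1+3t t) = recurrence₃ t
recurrence-mod3 (2+3t t) = recurrence₄ t

mainTheorem6 : ∀ (n : ℕ) → 2 ≤ n →
    S n ≈ qPow ((n + 2) / 3) *S S (n ∸ 1) -S qPow ((2 * n + 1) / 3) *S S (n ∸ 2)
mainTheorem6 (suc (suc m)) (s≤s (s≤s _)) = recurrence-mod3 (mod3 m)
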